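{- Let $G$ and $H$ be graphs such that $H$ is a minor of $G$. If $G$ has a loose tree-decomposition of width $k$, then so does $H$.
   Context: Graphs are finite and simple. A loose tree-decomposition of $G$ is a pair $(T,\chi)$, $T$ a tree, $\chi:V(T)\to2^{V(G)}$, such that (L1) for each $x\in V(G)$ the nodes $t$ with $x\in\chi(t)$ induce a nonempty connected subtree of $T$; (L2) for every edge $xy\in E(G)$ there is a tree edge $t_1t_2$ with $xy\in E(G[\chi(t_1)\cup\chi(t_2)])$; (L3) for every tree edge $t_1t_2$, $|E(G[\chi(t_1)\cup\chi(t_2)])\setminus(E(G[\chi(t_1)])\cup E(G[\chi(t_2)]))|\le1$. Its width is $\max_t|\chi(t)|$. -}

module Defs where

open import Data.Nat using (ℕ; _≤_; _⊔_)
open import Data.Fin using (Fin)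
open import Data.Fin.Subset using (Subset; _∈_; ∣_∣)
open import Data.Bool using (Bool; true; false; T)
open import Data.List using (List; []; _∷_; _++_; [_]; length; map; foldr; allFin)
open import Data.List.Relation.Unary.Unique.Propositional using (Unique)
open import Data.Product using (Σ; ∃; ∃-syntax; _×_; _,_)
open import Data.Sum using (_⊎_)
open import Data.Unit using (⊤)
open import Data.Empty using (⊥)
open import Relation.Nullary using (¬_)
open import Relation.Binary.PropositionalEquality using (_≡_; _≢_)

record Graph (n : ℕ) : Set where
  field
    adj   : Fin n → Fin n → Bool
    sym   : ∀ x y → adj x y ≡ adj y x
    irref : ∀ x → adj x x ≡ false
open Graph public

E : ∀ {n} → Graph n → Fin n → Fin n → Set
E G x y = T (adj G x y)

data WalkIn {n} (G : Graph n) (S : Fin n → Set) : Fin n → Fin n → Set where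
  here : ∀ {x} → S x → WalkIn G S x x
  step : ∀ {x y z} → S x → E G x y → WalkIn G S y z → WalkIn G S x z

ConnectedIn : ∀ {n} → Graph n → (Fin n → Set) → Set
ConnectedIn G S = ∀ x y → S x → S y → WalkIn G S x y

ConnectedNonempty : ∀ {n} → Graph n → (Fin n → Set) → Set
ConnectedNonempty {n} G S = (∃[ x ] S x) × ConnectedIn G S

Connected : ∀ {n} → Graph n → Set
Connected G = ConnectedIn G (λ _ → ⊤)

IsWalkList : ∀ {n} → Graph n → List (Fin n) → Set
IsWalkList G []            = ⊤
IsWalkList G (x ∷ [])      = ⊤
IsWalkList G (x ∷ y ∷ r)   = E G x y × IsWalkList G (y ∷ r)

-- a cycle: distinct vertices v ∷ rest (at least 3 of them),
-- consecutive ones adjacent, and the last adjacent to v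
HasCycle : ∀ {n} → Graph n → Set
HasCycle {n} G =
  Σ (Fin n) λ v → Σ (List (Fin n)) λ rest →
    (2 ≤ length rest) × Unique (v ∷ rest) × IsWalkList G (v ∷ rest ++ [ v ])

record IsTree {m} (T : Graph m) : Set where
  field
    nonempty  : Fin m
    connected : Connected T
    acyclic   : ¬ HasCycle T

-- xy ∈ E(G[χ(t₁) ∪ χ(t₂)]) \ (E(G[χ(t₁)]) ∪ E(G[χ(t₂)]))
CrossEdge : ∀ {n} → Graph n → Subset n → Subset n → Fin n → Fin n → Set
CrossEdge G A B x y =
  E G x y × (x ∈ A ⊎ x ∈ B) × (y ∈ A ⊎ y ∈ B)
  × ¬ (x ∈ A × y ∈ A) × ¬ (x ∈ B × y ∈ B)

SameEdge : ∀ {n} → Fin n → Fin n → Fin n → Fin n → Set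
SameEdge x y x' y' = (x ≡ x' × y ≡ y') ⊎ (x ≡ y' × y ≡ x')

record IsLooseTD {n m} (G : Graph n) (Tr : Graph m) (χ : Fin m → Subset n) : Set where
  field
    tree : IsTree Tr
    L1 : ∀ x → ConnectedNonempty Tr (λ t → x ∈ χ t)
    L2 : ∀ x y → E G x y →
         ∃[ t₁ ] ∃[ t₂ ] (E Tr t₁ t₂ × (x ∈ χ t₁ ⊎ x ∈ χ t₂) × (y ∈ χ t₁ ⊎ y ∈ χ t₂))
    L3 : ∀ t₁ t₂ → E Tr t₁ t₂ → ∀ x y x' y' →
         CrossEdge G (χ t₁) (χ t₂) x y → CrossEdge G (χ t₁) (χ t₂) x' y' →
         SameEdge x y x' y'

width : ∀ {n m} → (Fin m → Subset n) → ℕ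
width {n} {m} χ = foldr _⊔_ 0 (map (λ t → ∣ χ t ∣) (allFin m))

HasLooseTDWidth≤ : ∀ {n} → Graph n → ℕ → Set
HasLooseTDWidth≤ {n} G k =
  Σ ℕ λ m → Σ (Graph m) λ Tr → Σ (Fin m → Subset n) λ χ →
    IsLooseTD G Tr χ × width χ ≤ k

HasLooseTDWidth : ∀ {n} → Graph n → ℕ → Set
HasLooseTDWidth {n} G k =
  Σ ℕ λ m → Σ (Graph m) λ Tr → Σ (Fin m → Subset n) λ χ →
    IsLooseTD G Tr χ × width χ ≡ k

record MinorModel {h g} (H : Graph h) (G : Graph g) : Set where
  field
    branch   : Fin h → Subset g
    conn     : ∀ v → ConnectedNonempty G (λ x → x ∈ branch v)
    disjoint : ∀ u v x → u ≢ v → x ∈ branch u → x ∈ branch v → ⊥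
    edges    : ∀ u v → E H u v →
               ∃[ x ] ∃[ y ] (x ∈ branch u × y ∈ branch v × E G x y)

IsMinor : ∀ {h g} → Graph h → Graph g → Set
IsMinor H G = MinorModel H G

-- Keep the tree T and replace every bag χ t by the set of branch sets meeting it.
-- (L1) holds because a branch set is connected and each of its edges is covered,
-- and bags shrink because branch sets are disjoint. For (L3), a cross edge uv of H
-- at a tree edge t₁t₂ separates the subtrees T_u ∋ t₁ and T_v ∋ t₂, which in a
-- tree can only be joined by t₁t₂ itself; so the G-edge realising uv is a cross
-- edge at t₁t₂, and distinct cross edges of H yield distinct cross edges of G.
module Submission where

open import Defs
open import Data.Nat using (ℕ; _≤_; _⊔_; z≤n; s≤s)
open import Data.Nat.Properties using (≤-trans; ≤-reflexive; ⊔-mono-≤)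
open import Data.Fin using (Fin; zero; suc; _≟_)
open import Data.Fin.Properties using (suc-injective)
open import Data.Fin.Subset using (Subset; _∈_; ∣_∣; _∩_; Nonempty; inside; outside; _-_)
open import Data.Fin.Subset.Properties
  using (nonempty?; x∈p∩q⁺; x∈p∩q⁻; x∈p∧x≢y⇒x∈p-y; x∈p⇒∣p-x∣<∣p∣)
open import Data.Vec using ([]; _∷_; tabulate; here; there)
open import Data.Vec.Properties using (lookup∘tabulate; []=⇒lookup; lookup⇒[]=)
open import Data.Bool using (T)
open import Data.List using (List; []; _∷_; _++_; [_]; length; map; foldr; allFin)
import Data.List.Relation.Unary.Any as Any
open import Data.List.Relation.Unary.All using ([])
open import Data.List.Relation.Unary.All.Properties using (¬Any⇒All¬)
open import Data.List.Relation.Unary.AllPairs using ([]; _∷_)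
open import Data.List.Relation.Unary.Unique.Propositional using (Unique)
open import Data.List.Membership.Propositional using () renaming (_∈_ to _∈ₗ_)
open import Data.List.Membership.DecPropositional using (_∈?_)
open import Data.Product using (∃; ∃₂; ∃-syntax; _×_; _,_; proj₁; proj₂)
open import Data.Sum using (_⊎_; inj₁; inj₂) renaming (swap to ⊎-swap)
open import Data.Unit using (tt)
open import Data.Empty using (⊥; ⊥-elim)
open import Relation.Binary using (Rel; _⇒_; DecidableEquality)
open import Relation.Binary.Construct.Closure.ReflexiveTransitive using (Star; ε; _◅_; _◅◅_)
open import Relation.Nullary using (¬_; yes; no)
open import Relation.Nullary.Decidable using (does; proof; dec-true; _×-dec_)
open import Relation.Nullary.Reflects using (Reflects; invert)
open import Relation.Unary using (Pred; Decidable; _⊆_)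
open import Level using (0ℓ)
open import Relation.Binary.PropositionalEquality as ≡ using (_≡_; _≢_; refl)

E-sym : ∀ {n} (X : Graph n) {a b} → E X a b → E X b a
E-sym X {a} {b} = ≡.subst T (Graph.sym X a b)

E-irrefl : ∀ {n} (X : Graph n) {a} → ¬ E X a a
E-irrefl X {a} = ≡.subst T (irref X a)

CrossEdge-swap : ∀ {n} (X : Graph n) {P Q x y} → CrossEdge X P Q x y → CrossEdge X Q P x y
CrossEdge-swap X (e , x∈ , y∈ , ¬P , ¬Q) = e , ⊎-swap x∈ , ⊎-swap y∈ , ¬Q , ¬P

module _ {n} {X : Graph n} where

  WalkIn-map : ∀ {S S' : Fin n → Set} → S ⊆ S' → ∀ {a b} → WalkIn X S a b → WalkIn X S' a b
  WalkIn-map S⊆S' (here s)     = here (S⊆S' s)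
  WalkIn-map S⊆S' (step s e w) = step (S⊆S' s) e (WalkIn-map S⊆S' w)

  infixr 5 _++ʷ_
  _++ʷ_ : ∀ {S a b c} → WalkIn X S a b → WalkIn X S b c → WalkIn X S a c
  here _     ++ʷ w' = w'
  step s e w ++ʷ w' = step s e (w ++ʷ w')

  WalkIn-head : ∀ {S a b} → WalkIn X S a b → S a
  WalkIn-head (here s)     = s
  WalkIn-head (step s _ _) = s

  WalkIn-≤1 : ∀ {S a b} → a ≡ b ⊎ E X a b → S a → S b → WalkIn X S a b
  WalkIn-≤1 (inj₁ refl) sa sb = here sa
  WalkIn-≤1 (inj₂ e)    sa sb = step sa e (here sb)

data VertexWalk {A : Set} (Q : Rel A 0ℓ) : A → A → List A → Set where
  stop : ∀ {a} → VertexWalk Q a a [ a ]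
  step : ∀ {a c b vs} → Q a c → VertexWalk Q c b vs → VertexWalk Q a b (a ∷ vs)

module _ {A : Set} {Q : Rel A 0ℓ} where

  VertexWalk-suffix : ∀ {a b c vs} → VertexWalk Q b c vs → Unique vs → a ∈ₗ vs →
                      ∃ λ ws → VertexWalk Q a c ws × Unique ws
  VertexWalk-suffix stop         u       (Any.here refl) = _ , stop , u
  VertexWalk-suffix stop         _       (Any.there ())
  VertexWalk-suffix p@(step _ _) u       (Any.here refl) = _ , p , u
  VertexWalk-suffix (step _ p)   (_ ∷ u) (Any.there i)   = VertexWalk-suffix p u i

  -- Loop erasure: cut the walk back to the first revisit of its current head.
  loop-erase : DecidableEquality A → ∀ {a b} → Star Q a b → ∃ λ vs → VertexWalk Q a b vs × Unique vs
  loop-erase _≟ₐ_ {a} ε = [ a ] , stop , [] ∷ []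
  loop-erase _≟ₐ_ {a} (q ◅ qs) with loop-erase _≟ₐ_ qs
  ... | vs , p , u with _∈?_ _≟ₐ_ a vs
  ...   | yes a∈vs = VertexWalk-suffix p u a∈vs
  ...   | no  a∉vs = a ∷ vs , step q p , ¬Any⇒All¬ vs a∉vs ∷ u

  VertexWalk-nonempty : ∀ {a b vs} → VertexWalk Q a b vs → 1 ≤ length vs
  VertexWalk-nonempty stop       = s≤s z≤n
  VertexWalk-nonempty (step _ _) = s≤s z≤n

VertexWalk⇒IsWalkList : ∀ {n} {X : Graph n} {Q : Rel (Fin n) 0ℓ} → Q ⇒ E X →
                        ∀ {a b vs w} → VertexWalk Q a b vs → E X b w → IsWalkList X (vs ++ [ w ])
VertexWalk⇒IsWalkList Q⇒E stop                  e = e , tt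
VertexWalk⇒IsWalkList Q⇒E (step q stop)         e = Q⇒E q , e , tt
VertexWalk⇒IsWalkList Q⇒E (step q p@(step _ _)) e = Q⇒E q , VertexWalk⇒IsWalkList Q⇒E p e

module _ {m} {Tr : Graph m} where

  OtherEdge : Fin m → Fin m → Rel (Fin m) 0ℓ
  OtherEdge t₁ t₂ a b = E Tr a b × ¬ SameEdge a b t₁ t₂

  no-detour : ¬ HasCycle Tr → ∀ {t₁ t₂} → E Tr t₁ t₂ → ¬ Star (OtherEdge t₁ t₂) t₁ t₂
  no-detour acyclic {t₁} {t₂} e walk with loop-erase _≟_ walk
  ... | _ , stop , _                = E-irrefl Tr e
  ... | _ , step q stop , _         = proj₂ q (inj₁ (refl , refl))
  ... | _ , p@(step _ (step _ p′)) , u =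
    acyclic (t₁ , _ , s≤s (VertexWalk-nonempty p′) , u , VertexWalk⇒IsWalkList proj₁ p (E-sym Tr e))

  SameEdge-ends : ∀ {S : Pred (Fin m) 0ℓ} {a b t₁ t₂} → SameEdge a b t₁ t₂ → S a → S b → S t₁ × S t₂
  SameEdge-ends (inj₁ (refl , refl)) sa sb = sa , sb
  SameEdge-ends (inj₂ (refl , refl)) sa sb = sb , sa

  WalkIn⇒Star-OtherEdge : ∀ {S t₁ t₂} → ¬ (S t₁ × S t₂) →
                          ∀ {a b} → WalkIn Tr S a b → Star (OtherEdge t₁ t₂) a b
  WalkIn⇒Star-OtherEdge ¬both (here _)     = ε
  WalkIn⇒Star-OtherEdge ¬both (step s e w) =
    (e , λ same → ¬both (SameEdge-ends same s (WalkIn-head w))) ◅ WalkIn⇒Star-OtherEdge ¬both w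

  module Separation (acyclic : ¬ HasCycle Tr) {t₁ t₂} (e : E Tr t₁ t₂)
                    {A B : Pred (Fin m) 0ℓ} (A-conn : ConnectedIn Tr A) (B-conn : ConnectedIn Tr B)
                    (t₁∈A : A t₁) (t₂∉A : ¬ A t₂) (t₂∈B : B t₂) (t₁∉B : ¬ B t₁) where

    private
      fromA : ∀ {a} → A a → Star (OtherEdge t₁ t₂) t₁ a
      fromA a∈A = WalkIn⇒Star-OtherEdge (λ (_ , t₂∈A) → t₂∉A t₂∈A) (A-conn _ _ t₁∈A a∈A)

      toB : ∀ {b} → B b → Star (OtherEdge t₁ t₂) b t₂
      toB b∈B = WalkIn⇒Star-OtherEdge (λ (t₁∈B , _) → t₁∉B t₁∈B) (B-conn _ _ b∈B t₂∈B)

    no-common-node : ∀ {a} → A a → B a → ⊥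
    no-common-node a∈A a∈B = no-detour acyclic e (fromA a∈A ◅◅ toB a∈B)

    joining-edge : ∀ {a b} → A a → B b → E Tr a b → a ≡ t₁ × b ≡ t₂
    joining-edge {a} {b} a∈A b∈B eab with (a ≟ t₁) ×-dec (b ≟ t₂)
    ... | yes ends = ends
    ... | no ¬ends = ⊥-elim (no-detour acyclic e (fromA a∈A ◅◅ (eab , other) ◅ toB b∈B))
      where
      other : ¬ SameEdge a b t₁ t₂
      other (inj₁ ends)       = ¬ends ends
      other (inj₂ (refl , _)) = t₂∉A a∈A

module _ {n} {P : Pred (Fin n) 0ℓ} (P? : Decidable P) where

  select : Subset n
  select = tabulate (λ v → does (P? v))

  ∈-select⁺ : ∀ {v} → P v → v ∈ select
  ∈-select⁺ {v} pv = lookup⇒[]= v select (≡.trans (lookup∘tabulate _ v) (dec-true (P? v) pv))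

  ∈-select⁻ : ∀ {v} → v ∈ select → P v
  ∈-select⁻ {v} v∈ =
    invert (≡.subst (Reflects (P v)) (≡.trans (≡.sym (lookup∘tabulate _ v)) ([]=⇒lookup v∈)) (proof (P? v)))

injection⇒∣p∣≤∣q∣ : ∀ {h g} (p : Subset h) (q : Subset g) (f : ∀ v → v ∈ p → Fin g) →
                    (∀ v i → f v i ∈ q) → (∀ u v i j → f u i ≡ f v j → u ≡ v) → ∣ p ∣ ≤ ∣ q ∣
injection⇒∣p∣≤∣q∣ [] q f f∈q f-inj = z≤n
injection⇒∣p∣≤∣q∣ (outside ∷ p) q f f∈q f-inj =
  injection⇒∣p∣≤∣q∣ p q (λ v i → f (suc v) (there i)) (λ v i → f∈q (suc v) (there i))
    (λ u v i j eq → suc-injective (f-inj (suc u) (suc v) (there i) (there j) eq))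
injection⇒∣p∣≤∣q∣ (inside ∷ p) q f f∈q f-inj =
  ≤-trans (s≤s (injection⇒∣p∣≤∣q∣ p (q - f zero here) (λ v i → f (suc v) (there i))
                  (λ v i → x∈p∧x≢y⇒x∈p-y (f∈q (suc v) (there i)) (λ eq → suc≢zero (f-inj _ _ _ _ eq)))
                  (λ u v i j eq → suc-injective (f-inj (suc u) (suc v) (there i) (there j) eq))))
          (x∈p⇒∣p-x∣<∣p∣ (f∈q zero here))
  where
  suc≢zero : ∀ {k} {v : Fin k} → suc v ≢ zero
  suc≢zero ()

width-mono : ∀ {n n' m} (χ : Fin m → Subset n) (χ' : Fin m → Subset n') →
             (∀ t → ∣ χ t ∣ ≤ ∣ χ' t ∣) → width χ ≤ width χ'
width-mono {m = m} χ χ' le = go (allFin m)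
  where
  go : ∀ ts → foldr _⊔_ 0 (map (λ t → ∣ χ t ∣) ts) ≤ foldr _⊔_ 0 (map (λ t → ∣ χ' t ∣) ts)
  go []       = z≤n
  go (t ∷ ts) = ⊔-mono-≤ (le t) (go ts)

module MinorDecomposition {h g m} {H : Graph h} {G : Graph g} {Tr : Graph m} {χ : Fin m → Subset g}
                          (M : MinorModel H G) (td : IsLooseTD G Tr χ) where

  open MinorModel M
  open IsLooseTD td

  meets? : ∀ t → Decidable (λ v → Nonempty (branch v ∩ χ t))
  meets? t v = nonempty? (branch v ∩ χ t)

  χᴴ : Fin m → Subset h
  χᴴ t = select (meets? t)

  Tᴴ : Fin h → Pred (Fin m) 0ℓ
  Tᴴ u t = u ∈ χᴴ t

  ∈χᴴ⁺ : ∀ {u x t} → x ∈ branch u → x ∈ χ t → u ∈ χᴴ t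
  ∈χᴴ⁺ x∈u x∈t = ∈-select⁺ (meets? _) (_ , x∈p∩q⁺ (x∈u , x∈t))

  ∈χᴴ⁻ : ∀ {u t} → u ∈ χᴴ t → ∃ λ x → x ∈ branch u × x ∈ χ t
  ∈χᴴ⁻ {u} {t} u∈t with ∈-select⁻ (meets? t) u∈t
  ... | x , x∈∩ = x , x∈p∩q⁻ (branch u) (χ t) x∈∩

  branch-unique : ∀ {u v x} → x ∈ branch u → x ∈ branch v → u ≡ v
  branch-unique {u} {v} x∈u x∈v with u ≟ v
  ... | yes u≡v = u≡v
  ... | no  u≢v = ⊥-elim (disjoint u v _ u≢v x∈u x∈v)

  edge-covered : ∀ {x y} → E G x y → ∃₂ λ s s' → x ∈ χ s × y ∈ χ s' × (s ≡ s' ⊎ E Tr s s')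
  edge-covered {x} {y} exy with L2 x y exy
  ... | s₁ , s₂ , e , inj₁ x∈s₁ , inj₁ y∈s₁ = s₁ , s₁ , x∈s₁ , y∈s₁ , inj₁ refl
  ... | s₁ , s₂ , e , inj₁ x∈s₁ , inj₂ y∈s₂ = s₁ , s₂ , x∈s₁ , y∈s₂ , inj₂ e
  ... | s₁ , s₂ , e , inj₂ x∈s₂ , inj₁ y∈s₁ = s₂ , s₁ , x∈s₂ , y∈s₁ , inj₂ (E-sym Tr e)
  ... | s₁ , s₂ , e , inj₂ x∈s₂ , inj₂ y∈s₂ = s₂ , s₂ , x∈s₂ , y∈s₂ , inj₁ refl

  walk-in-bags : ∀ {u x t t'} → x ∈ branch u → x ∈ χ t → x ∈ χ t' → WalkIn Tr (Tᴴ u) t t'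
  walk-in-bags {x = x} x∈u x∈t x∈t' = WalkIn-map (∈χᴴ⁺ x∈u) (proj₂ (L1 x) _ _ x∈t x∈t')

  lift-walk : ∀ {u x x' t t'} → WalkIn G (λ z → z ∈ branch u) x x' → x ∈ χ t → x' ∈ χ t' →
              WalkIn Tr (Tᴴ u) t t'
  lift-walk (here x∈u) x∈t x∈t' = walk-in-bags x∈u x∈t x∈t'
  lift-walk (step x∈u exy w) x∈t y∈t' with edge-covered exy
  ... | s , s' , x∈s , y∈s' , s≤1s' =
    walk-in-bags x∈u x∈t x∈s
    ++ʷ WalkIn-≤1 s≤1s' (∈χᴴ⁺ x∈u x∈s) (∈χᴴ⁺ (WalkIn-head w) y∈s')
    ++ʷ lift-walk w y∈s' y∈t'

  L1ᴴ : ∀ u → ConnectedNonempty Tr (Tᴴ u)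
  L1ᴴ u with conn u
  ... | (x , x∈u) , u-conn = nonempty , connected
    where
    nonempty : ∃ (Tᴴ u)
    nonempty = let (t , x∈t) = proj₁ (L1 x) in t , ∈χᴴ⁺ x∈u x∈t
    connected : ConnectedIn Tr (Tᴴ u)
    connected t t' u∈t u∈t' with ∈χᴴ⁻ u∈t | ∈χᴴ⁻ u∈t'
    ... | y , y∈u , y∈t | y' , y'∈u , y'∈t' = lift-walk (u-conn y y' y∈u y'∈u) y∈t y'∈t'

  L2ᴴ : ∀ u v → E H u v →
        ∃[ t₁ ] ∃[ t₂ ] (E Tr t₁ t₂ × (u ∈ χᴴ t₁ ⊎ u ∈ χᴴ t₂) × (v ∈ χᴴ t₁ ⊎ v ∈ χᴴ t₂))
  L2ᴴ u v euv with edges u v euv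
  ... | x , y , x∈u , y∈v , exy with L2 x y exy
  ... | t₁ , t₂ , e , x∈ , y∈ = t₁ , t₂ , e , lift x∈u x∈ , lift y∈v y∈
    where
    lift : ∀ {w z} → z ∈ branch w → z ∈ χ t₁ ⊎ z ∈ χ t₂ → w ∈ χᴴ t₁ ⊎ w ∈ χᴴ t₂
    lift z∈w (inj₁ z∈t₁) = inj₁ (∈χᴴ⁺ z∈w z∈t₁)
    lift z∈w (inj₂ z∈t₂) = inj₂ (∈χᴴ⁺ z∈w z∈t₂)

  LiftedCrossEdge : Fin m → Fin m → Fin h → Fin h → Set
  LiftedCrossEdge t₁ t₂ u v = ∃₂ λ x y → x ∈ branch u × y ∈ branch v × CrossEdge G (χ t₁) (χ t₂) x y

  lift-cross-edge : ∀ {t₁ t₂ u v} → E Tr t₁ t₂ → E H u v →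
                    u ∈ χᴴ t₁ → ¬ u ∈ χᴴ t₂ → v ∈ χᴴ t₂ → ¬ v ∈ χᴴ t₁ → LiftedCrossEdge t₁ t₂ u v
  lift-cross-edge {t₁} {t₂} {u} {v} e euv u∈t₁ u∉t₂ v∈t₂ v∉t₁ with edges u v euv
  ... | x , y , x∈u , y∈v , exy with edge-covered exy
  ... | _ , _ , x∈s , y∈s' , s≤1s' = realise x∈s y∈s' s≤1s'
    where
    open Separation (IsTree.acyclic tree) e (proj₂ (L1ᴴ u)) (proj₂ (L1ᴴ v)) u∈t₁ u∉t₂ v∈t₂ v∉t₁
    realise : ∀ {s s'} → x ∈ χ s → y ∈ χ s' → s ≡ s' ⊎ E Tr s s' → LiftedCrossEdge t₁ t₂ u v
    realise x∈s y∈s (inj₁ refl) = ⊥-elim (no-common-node (∈χᴴ⁺ x∈u x∈s) (∈χᴴ⁺ y∈v y∈s))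
    realise x∈s y∈s' (inj₂ ess') with joining-edge (∈χᴴ⁺ x∈u x∈s) (∈χᴴ⁺ y∈v y∈s') ess'
    ... | refl , refl =
      x , y , x∈u , y∈v , exy , inj₁ x∈s , inj₂ y∈s' ,
      (λ (_ , y∈t₁) → v∉t₁ (∈χᴴ⁺ y∈v y∈t₁)) , (λ (x∈t₂ , _) → u∉t₂ (∈χᴴ⁺ x∈u x∈t₂))

  lift-CrossEdge : ∀ {t₁ t₂ u v} → E Tr t₁ t₂ → CrossEdge H (χᴴ t₁) (χᴴ t₂) u v → LiftedCrossEdge t₁ t₂ u v
  lift-CrossEdge e (euv , inj₁ u₁ , inj₁ v₁ , ¬₁ , ¬₂) = ⊥-elim (¬₁ (u₁ , v₁))
  lift-CrossEdge e (euv , inj₂ u₂ , inj₂ v₂ , ¬₁ , ¬₂) = ⊥-elim (¬₂ (u₂ , v₂))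
  lift-CrossEdge e (euv , inj₁ u₁ , inj₂ v₂ , ¬₁ , ¬₂) =
    lift-cross-edge e euv u₁ (λ u₂ → ¬₂ (u₂ , v₂)) v₂ (λ v₁ → ¬₁ (u₁ , v₁))
  lift-CrossEdge e (euv , inj₂ u₂ , inj₁ v₁ , ¬₁ , ¬₂)
    with lift-cross-edge (E-sym Tr e) euv u₂ (λ u₁ → ¬₁ (u₁ , v₁)) v₁ (λ v₂ → ¬₂ (u₂ , v₂))
  ... | x , y , x∈u , y∈v , cross = x , y , x∈u , y∈v , CrossEdge-swap G cross

  L3ᴴ : ∀ t₁ t₂ → E Tr t₁ t₂ → ∀ u v u' v' →
        CrossEdge H (χᴴ t₁) (χᴴ t₂) u v → CrossEdge H (χᴴ t₁) (χᴴ t₂) u' v' → SameEdge u v u' v'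
  L3ᴴ t₁ t₂ e u v u' v' c c' with lift-CrossEdge e c | lift-CrossEdge e c'
  ... | x , y , x∈u , y∈v , cx | x' , y' , x'∈u' , y'∈v' , cx'
    with L3 t₁ t₂ e x y x' y' cx cx'
  ... | inj₁ (refl , refl) = inj₁ (branch-unique x∈u x'∈u' , branch-unique y∈v y'∈v')
  ... | inj₂ (refl , refl) = inj₂ (branch-unique x∈u y'∈v' , branch-unique y∈v x'∈u')

  isLooseTD : IsLooseTD H Tr χᴴ
  isLooseTD = record { tree = tree ; L1 = L1ᴴ ; L2 = L2ᴴ ; L3 = L3ᴴ }

  ∣χᴴ∣≤∣χ∣ : ∀ t → ∣ χᴴ t ∣ ≤ ∣ χ t ∣
  ∣χᴴ∣≤∣χ∣ t = injection⇒∣p∣≤∣q∣ (χᴴ t) (χ t) (λ v v∈ → proj₁ (∈χᴴ⁻ v∈))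
    (λ v v∈ → proj₂ (proj₂ (∈χᴴ⁻ v∈)))
    (λ u v u∈ v∈ eq → branch-unique (proj₁ (proj₂ (∈χᴴ⁻ u∈)))
                        (≡.subst (_∈ branch v) (≡.sym eq) (proj₁ (proj₂ (∈χᴴ⁻ v∈)))))

lemma11 : ∀ {h g} (H : Graph h) (G : Graph g) (k : ℕ) →
    IsMinor H G → HasLooseTDWidth G k → HasLooseTDWidth≤ H k
lemma11 H G k M (m , Tr , χ , td , width≡k) =
  m , Tr , χᴴ , isLooseTD , ≤-trans (width-mono χᴴ χ ∣χᴴ∣≤∣χ∣) (≤-reflexive width≡k)
  where open MinorDecomposition M td
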